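{- For every integer $b\ge0$, \[ \operatorname{tr}(A_b)=p(b)+\sum_{i=0}^{b-1}2^{b-i-1}p(i), \] where $p(m)$ denotes the number of unordered integer partitions of $m$ (with $p(0)=1$).
   Context: An ordered partition (composition) of a positive integer $b$ is a finite sequence of positive integers with sum $b$. For ordered partitions $q=(q_1,\ldots,q_k)$, $r=(r_1,\ldots,r_\ell)$ of $b$, a nontrivial embedding of $q$ into $r$ is a choice of indices $1\le i_2<\cdots<i_k\le\ell$ with $q_j\le r_{i_j}$ for $2\le j\le k$ (when $k=1$ there is exactly one, the empty choice). For $b\ge1$, $A_b$ is the matrix indexed by ordered partitions of $b$ whose $(q,r)$ entry is the number of nontrivial embeddings of $q$ into $r$ plus $1$ if $q=r$. By convention $A_0=(1)$. -}

module Defs where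

open import Data.Nat using (ℕ; zero; suc; _+_; _*_; _∸_; _^_; _≤_; _≤?_; _≟_)
open import Data.List using (List; []; _∷_; map; concatMap; applyUpTo; length; filter)
open import Data.Nat.ListAction using (sum)
open import Data.List.Relation.Unary.Linked using (Linked)
open import Data.Bool using (if_then_else_)
open import Relation.Nullary.Decidable using (does)
open import Data.List.Relation.Unary.Linked using () renaming (linked? to linked?)

-- The fuel argument is
-- only for termination; fuel b suffices (each part is ≥ 1).
compsF : ℕ → ℕ → List (List ℕ)
compsF _       zero    = [] ∷ []
compsF zero    (suc _) = []
compsF (suc f) b       = concatMap (λ k → map (k ∷_) (compsF f (b ∸ k))) (applyUpTo suc b)

compositions : ℕ → List (List ℕ)
compositions b = compsF b b

-- emb xs r : number of index choices i₁ < … < iₘ in r with xs_j ≤ r_{i_j}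
emb : List ℕ → List ℕ → ℕ
emb []       _        = 1
emb (_ ∷ _)  []       = 0
emb (x ∷ xs) (y ∷ ys) = (if does (x ≤? y) then emb xs ys else 0) + emb (x ∷ xs) ys

-- number of nontrivial embeddings of q = (q₁,…,q_k) into r:
-- choices 1 ≤ i₂ < … < i_k ≤ ℓ with q_j ≤ r_{i_j}
nontrivEmb : List ℕ → List ℕ → ℕ
nontrivEmb []       r = 0   -- never used for b ≥ 1 (compositions are nonempty)
nontrivEmb (_ ∷ qs) r = emb qs r

eqList : List ℕ → List ℕ → Data.Bool.Bool
eqList []       []       = Data.Bool.true
eqList (x ∷ xs) (y ∷ ys) = does (x ≟ y) Data.Bool.∧ eqList xs ys
eqList _        _        = Data.Bool.false

entryA : List ℕ → List ℕ → ℕ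
entryA q r = nontrivEmb q r + (if eqList q r then 1 else 0)

-- trace of A_b (A_0 = (1) by convention)
trA : ℕ → ℕ
trA zero        = 1
trA b@(suc _)   = sum (map (λ q → entryA q q) (compositions b))

partitions : ℕ → List (List ℕ)
partitions m = filter (linked? (λ x y → y Data.Nat.≤? x)) (compositions m)

p : ℕ → ℕ
p m = length (partitions m)

-- Write a composition q of b as x ∷ c. Its diagonal entry emb c q + 1 is one more than the number
-- of j with x ≥ c₁ ≥ ⋯ ≥ c_j, i.e. the number of weakly decreasing prefixes of q (the empty one
-- included). A decreasing prefix of sum i together with the rest of q is a partition of i followed
-- by an arbitrary composition of b − i, and there are 2^(b−i−1) of the latter (one if i = b).
-- Summing over i gives the formula, the i = 0 term counting the empty prefixes.
-- In the proof this bijection becomes a recurrence on the first part of the composition.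
module Submission where

open import Defs
open import Data.Nat using (ℕ; _+_; _*_; _∸_; _^_)
open import Data.List using (map; upTo)
open import Data.Nat.ListAction using (sum)
open import Relation.Binary.PropositionalEquality using (_≡_)

open import Data.Bool using (Bool; true; false; if_then_else_; _∧_)
open import Data.Bool.Properties using (if-eta; if-float; if-∧)
open import Data.List using (List; []; _∷_; _++_; concat; applyUpTo; filter; length)
open import Data.List.Properties using (map-∘; map-cong; map-cong-local; map-applyUpTo; map-++; applyUpTo-∷ʳ)
open import Data.List.Relation.Unary.All.Properties using (applyUpTo⁺₁)
open import Data.List.Relation.Unary.Linked using (linked?)
open import Data.Nat using (zero; suc; _≤_; _<_; s≤s; _≤?_; _≟_)
open import Data.Nat.Induction using (<-rec)
open import Data.Nat.ListAction.Properties using (sum-++)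
open import Data.Nat.Properties
open import Algebra.Properties.CommutativeSemigroup +-commutativeSemigroup using (interchange)
open import Function using (_∘_; id; const)
open import Relation.Binary.PropositionalEquality using (refl; sym; trans; cong; cong₂; module ≡-Reasoning)
open import Relation.Nullary.Decidable using (does; dec-true)
open import Relation.Unary using (Decidable)
open ≡-Reasoning

∸-∸-cancel : ∀ m {j i} → j ≤ i → m ∸ j ∸ (i ∸ j) ≡ m ∸ i
∸-∸-cancel m {j} j≤i = trans (∸-+-assoc m j _) (cong (m ∸_) (m+[n∸m]≡n j≤i))

sum-map-+ : ∀ {A : Set} (f g : A → ℕ) xs →
            sum (map (λ x → f x + g x) xs) ≡ sum (map f xs) + sum (map g xs)
sum-map-+ f g []       = refl
sum-map-+ f g (x ∷ xs) = trans (cong (f x + g x +_) (sum-map-+ f g xs)) (interchange (f x) (g x) _ _)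

sum-map-*ʳ : ∀ {A : Set} (f : A → ℕ) c xs → sum (map (λ x → f x * c) xs) ≡ sum (map f xs) * c
sum-map-*ʳ f c []       = refl
sum-map-*ʳ f c (x ∷ xs) = trans (cong (f x * c +_) (sum-map-*ʳ f c xs)) (sym (*-distribʳ-+ c (f x) _))

sum-map-if : ∀ {A : Set} b (f : A → ℕ) xs →
             sum (map (λ x → if b then f x else 0) xs) ≡ (if b then sum (map f xs) else 0)
sum-map-if true  f xs       = refl
sum-map-if false f []       = refl
sum-map-if false f (x ∷ xs) = sum-map-if false f xs

sum-map-concat : ∀ {A : Set} (f : A → ℕ) xss → sum (map f (concat xss)) ≡ sum (map (sum ∘ map f) xss)
sum-map-concat f []         = refl
sum-map-concat f (xs ∷ xss) = begin
  sum (map f (xs ++ concat xss))             ≡⟨ cong sum (map-++ f xs (concat xss)) ⟩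
  sum (map f xs ++ map f (concat xss))       ≡⟨ sum-++ (map f xs) _ ⟩
  sum (map f xs) + sum (map f (concat xss))  ≡⟨ cong (sum (map f xs) +_) (sum-map-concat f xss) ⟩
  sum (map f xs) + sum (map (sum ∘ map f) xss) ∎

length-filter≡sum : ∀ {A : Set} {P : A → Set} (P? : Decidable P) xs →
                    length (filter P? xs) ≡ sum (map (λ x → if does (P? x) then 1 else 0) xs)
length-filter≡sum P? []       = refl
length-filter≡sum P? (x ∷ xs) with does (P? x)
... | true  = cong suc (length-filter≡sum P? xs)
... | false = length-filter≡sum P? xs

map-applyUpTo-upTo : ∀ {A B : Set} (f : ℕ → A) (g : A → B) n → map g (applyUpTo f n) ≡ map (g ∘ f) (upTo n)
map-applyUpTo-upTo f g n = trans (map-applyUpTo f g n) (sym (map-applyUpTo id (g ∘ f) n))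

∑< : ℕ → (ℕ → ℕ) → ℕ
∑< n f = sum (map f (upTo n))

∑<-suc : ∀ n f → ∑< (suc n) f ≡ f 0 + ∑< n (f ∘ suc)
∑<-suc n f = cong (f 0 +_) (cong sum (map-applyUpTo-upTo suc f n))

∑<-last : ∀ n f → ∑< (suc n) f ≡ ∑< n f + f n
∑<-last n f = begin
  sum (map f (upTo (suc n)))           ≡⟨ cong (sum ∘ map f) (sym (applyUpTo-∷ʳ id n)) ⟩
  sum (map f (upTo n ++ n ∷ []))       ≡⟨ cong sum (map-++ f (upTo n) _) ⟩
  sum (map f (upTo n) ++ f n ∷ [])     ≡⟨ sum-++ (map f (upTo n)) _ ⟩
  ∑< n f + (f n + 0)                   ≡⟨ cong (∑< n f +_) (+-identityʳ (f n)) ⟩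
  ∑< n f + f n                         ∎

∑<-cong : ∀ n {f g : ℕ → ℕ} → (∀ {j} → j < n → f j ≡ g j) → ∑< n f ≡ ∑< n g
∑<-cong n f≡g = cong sum (map-cong-local (applyUpTo⁺₁ id n f≡g))

∑<-triangle : ∀ L (g : ℕ → ℕ → ℕ) →
              ∑< L (λ j → ∑< (L ∸ j) (g j)) ≡ ∑< L (λ i → ∑< (suc i) (λ j → g j (i ∸ j)))
∑<-triangle zero    g = refl
∑<-triangle (suc L) g = begin
  ∑< (suc L) (λ j → ∑< (suc L ∸ j) (g j))
    ≡⟨ ∑<-last L _ ⟩
  ∑< L (λ j → ∑< (suc L ∸ j) (g j)) + ∑< (suc L ∸ L) (g L)
    ≡⟨ cong₂ _+_ (∑<-cong L peel) (cong (λ m → ∑< m (g L)) (m+n∸n≡m 1 L)) ⟩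
  ∑< L (λ j → ∑< (L ∸ j) (g j) + newCell j) + (g L 0 + 0)
    ≡⟨ cong₂ _+_ (sum-map-+ (λ j → ∑< (L ∸ j) (g j)) newCell (upTo L))
                 (trans (+-identityʳ (g L 0)) (cong (g L) (sym (n∸n≡0 L)))) ⟩
  ∑< L (λ j → ∑< (L ∸ j) (g j)) + ∑< L newCell + newCell L
    ≡⟨ cong (λ s → s + ∑< L newCell + newCell L) (∑<-triangle L g) ⟩
  ∑< L antidiagonal + ∑< L newCell + newCell L
    ≡⟨ +-assoc (∑< L antidiagonal) (∑< L newCell) (newCell L) ⟩
  ∑< L antidiagonal + (∑< L newCell + newCell L)
    ≡⟨ cong (∑< L antidiagonal +_) (sym (∑<-last L newCell)) ⟩
  ∑< L antidiagonal + ∑< (suc L) newCell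
    ≡⟨ sym (∑<-last L _) ⟩
  ∑< (suc L) antidiagonal ∎
  where
  antidiagonal : ℕ → ℕ
  antidiagonal i = ∑< (suc i) (λ j → g j (i ∸ j))

  newCell : ℕ → ℕ
  newCell j = g j (L ∸ j)

  peel : ∀ {j} → j < L → ∑< (suc L ∸ j) (g j) ≡ ∑< (L ∸ j) (g j) + newCell j
  peel {j} j<L = trans (cong (λ m → ∑< m (g j)) (+-∸-assoc 1 (<⇒≤ j<L))) (∑<-last (L ∸ j) (g j))

compsF-fuel : ∀ {f g m} → m ≤ f → m ≤ g → compsF f m ≡ compsF g m
compsF-fuel {m = zero} _ _ = refl
compsF-fuel {suc f} {suc g} {suc m} (s≤s m≤f) (s≤s m≤g) = cong concat (begin
  map (startingWith f) (applyUpTo suc (suc m))   ≡⟨ map-applyUpTo-upTo suc (startingWith f) (suc m) ⟩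
  map (startingWith f ∘ suc) (upTo (suc m))      ≡⟨ map-cong (λ j → cong (map (suc j ∷_)) (tails j)) (upTo (suc m)) ⟩
  map (startingWith g ∘ suc) (upTo (suc m))      ≡⟨ sym (map-applyUpTo-upTo suc (startingWith g) (suc m)) ⟩
  map (startingWith g) (applyUpTo suc (suc m))   ∎)
  where
  startingWith : ℕ → ℕ → List (List ℕ)
  startingWith h k = map (k ∷_) (compsF h (suc m ∸ k))

  tails : ∀ j → compsF f (m ∸ j) ≡ compsF g (m ∸ j)
  tails j = compsF-fuel (≤-trans (m∸n≤m m j) m≤f) (≤-trans (m∸n≤m m j) m≤g)

∑comp : ℕ → (List ℕ → ℕ) → ℕ
∑comp m w = sum (map w (compositions m))

∑comp-cong : ∀ m {v w : List ℕ → ℕ} → (∀ c → v c ≡ w c) → ∑comp m v ≡ ∑comp m w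
∑comp-cong m v≡w = cong sum (map-cong v≡w (compositions m))

∑comp-suc : ∀ n w → ∑comp (suc n) w ≡ ∑< (suc n) (λ j → ∑comp (n ∸ j) (λ c → w (suc j ∷ c)))
∑comp-suc n w = begin
  sum (map w (concat (map startingWith (applyUpTo suc (suc n)))))
    ≡⟨ sum-map-concat w (map startingWith (applyUpTo suc (suc n))) ⟩
  sum (map (sum ∘ map w) (map startingWith (applyUpTo suc (suc n))))
    ≡⟨ cong sum (sym (map-∘ (applyUpTo suc (suc n)))) ⟩
  sum (map (sum ∘ map w ∘ startingWith) (applyUpTo suc (suc n)))
    ≡⟨ cong sum (map-applyUpTo-upTo suc (sum ∘ map w ∘ startingWith) (suc n)) ⟩
  ∑< (suc n) (sum ∘ map w ∘ startingWith ∘ suc)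
    ≡⟨ ∑<-cong (suc n) (λ {j} _ → cong sum (trans (sym (map-∘ (compsF n (n ∸ j))))
                                     (cong (map (λ c → w (suc j ∷ c))) (compsF-fuel (m∸n≤m n j) ≤-refl)))) ⟩
  ∑< (suc n) (λ j → ∑comp (n ∸ j) (λ c → w (suc j ∷ c))) ∎
  where
  startingWith : ℕ → List (List ℕ)
  startingWith k = map (k ∷_) (compsF n (suc n ∸ k))

#compositions : ℕ → ℕ
#compositions m = ∑comp m (const 1)

#compositions≡2^[m∸1] : ∀ m → #compositions m ≡ 2 ^ (m ∸ 1)
#compositions≡2^[m∸1] zero          = refl
#compositions≡2^[m∸1] (suc zero)    = refl
#compositions≡2^[m∸1] (suc (suc k)) = begin
  #compositions (suc (suc k))
    ≡⟨ ∑comp-suc (suc k) (const 1) ⟩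
  ∑< (suc (suc k)) (λ j → #compositions (suc k ∸ j))
    ≡⟨ ∑<-suc (suc k) (λ j → #compositions (suc k ∸ j)) ⟩
  #compositions (suc k) + ∑< (suc k) (λ j → #compositions (k ∸ j))
    ≡⟨ cong (#compositions (suc k) +_) (sym (∑comp-suc k (const 1))) ⟩
  #compositions (suc k) + #compositions (suc k)
    ≡⟨ cong₂ _+_ (#compositions≡2^[m∸1] (suc k)) (trans (#compositions≡2^[m∸1] (suc k)) (sym (+-identityʳ (2 ^ k)))) ⟩
  2 ^ k + (2 ^ k + 0) ∎

emb-short : ∀ xs ys → length ys < length xs → emb xs ys ≡ 0
emb-short (x ∷ xs) []       _           = refl
emb-short (x ∷ xs) (y ∷ ys) (s≤s ys<xs) =
  cong₂ _+_ (trans (cong (λ e → if does (x ≤? y) then e else 0) (emb-short xs ys ys<xs)) (if-eta _))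
            (emb-short (x ∷ xs) ys (m<n⇒m<1+n ys<xs))

emb-refl : ∀ xs → emb xs xs ≡ 1
emb-refl []       = refl
emb-refl (x ∷ xs) =
  cong₂ _+_ (trans (cong (λ b → if b then emb xs xs else 0) (dec-true (x ≤? x) ≤-refl)) (emb-refl xs))
            (emb-short (x ∷ xs) xs (n<1+n _))

-- The number of j ≤ length c with x ≥ c₁ ≥ ⋯ ≥ c_j.
decrPrefixes : ℕ → List ℕ → ℕ
decrPrefixes x c = emb c (x ∷ c)

decrPrefixes-∷ : ∀ x y c → decrPrefixes x (y ∷ c) ≡ (if does (y ≤? x) then decrPrefixes y c else 0) + 1
decrPrefixes-∷ x y c = cong ((if does (y ≤? x) then decrPrefixes y c else 0) +_) (emb-refl (y ∷ c))

totalDecrPrefixes : ℕ → ℕ → ℕ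
totalDecrPrefixes m x = ∑comp m (decrPrefixes x)

totalDecrPrefixes-suc : ∀ n x →
  totalDecrPrefixes (suc n) x ≡
  ∑< (suc n) (λ j → (if does (suc j ≤? x) then totalDecrPrefixes (n ∸ j) (suc j) else 0) + #compositions (n ∸ j))
totalDecrPrefixes-suc n x = trans (∑comp-suc n (decrPrefixes x)) (∑<-cong (suc n) (λ {j} _ → begin
  ∑comp (n ∸ j) (λ c → decrPrefixes x (suc j ∷ c))
    ≡⟨ ∑comp-cong (n ∸ j) (decrPrefixes-∷ x (suc j)) ⟩
  ∑comp (n ∸ j) (λ c → (if does (suc j ≤? x) then decrPrefixes (suc j) c else 0) + 1)
    ≡⟨ sum-map-+ _ (const 1) (compositions (n ∸ j)) ⟩
  ∑comp (n ∸ j) (λ c → if does (suc j ≤? x) then decrPrefixes (suc j) c else 0) + #compositions (n ∸ j)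
    ≡⟨ cong (_+ #compositions (n ∸ j)) (sum-map-if (does (suc j ≤? x)) (decrPrefixes (suc j)) (compositions (n ∸ j))) ⟩
  (if does (suc j ≤? x) then totalDecrPrefixes (n ∸ j) (suc j) else 0) + #compositions (n ∸ j) ∎))

isPartition : List ℕ → Bool
isPartition c = does (linked? (λ x y → y ≤? x) c)

p≤ : ℕ → ℕ → ℕ
p≤ m x = ∑comp m (λ c → if isPartition (x ∷ c) then 1 else 0)

p≤-suc : ∀ n x → p≤ (suc n) x ≡ ∑< (suc n) (λ j → if does (suc j ≤? x) then p≤ (n ∸ j) (suc j) else 0)
p≤-suc n x = trans (∑comp-suc n (λ c → if isPartition (x ∷ c) then 1 else 0)) (∑<-cong (suc n) (λ {j} _ →
  trans (∑comp-cong (n ∸ j) (λ c → if-∧ (does (suc j ≤? x))))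
        (sum-map-if (does (suc j ≤? x)) _ (compositions (n ∸ j)))))

p-suc : ∀ n → p (suc n) ≡ ∑< (suc n) (λ j → p≤ (n ∸ j) (suc j))
p-suc n = trans (length-filter≡sum _ (compositions (suc n))) (∑comp-suc n (λ c → if isPartition c then 1 else 0))

p≤≡p : ∀ m x → m ≤ x → p≤ m x ≡ p m
p≤≡p zero    x _   = refl
p≤≡p (suc n) x n<x = begin
  p≤ (suc n) x
    ≡⟨ p≤-suc n x ⟩
  ∑< (suc n) (λ j → if does (suc j ≤? x) then p≤ (n ∸ j) (suc j) else 0)
    ≡⟨ ∑<-cong (suc n) (λ {j} j<1+n → cong (λ b → if b then p≤ (n ∸ j) (suc j) else 0)
                                             (dec-true (suc j ≤? x) (≤-trans j<1+n n<x))) ⟩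
  ∑< (suc n) (λ j → p≤ (n ∸ j) (suc j))
    ≡⟨ sym (p-suc n) ⟩
  p (suc n) ∎

totalDecrPrefixes≡convolution : ∀ m x → totalDecrPrefixes m x ≡ ∑< (suc m) (λ i → p≤ i x * #compositions (m ∸ i))
totalDecrPrefixes≡convolution = <-rec _ step
  where
  step : ∀ m → (∀ {k} → k < m → ∀ x → totalDecrPrefixes k x ≡ ∑< (suc k) (λ i → p≤ i x * #compositions (k ∸ i))) →
         ∀ x → totalDecrPrefixes m x ≡ ∑< (suc m) (λ i → p≤ i x * #compositions (m ∸ i))
  step zero    _  x = refl
  step (suc n) ih x = begin
    totalDecrPrefixes (suc n) x
      ≡⟨ totalDecrPrefixes-suc n x ⟩
    ∑< (suc n) (λ j → (if fits j then totalDecrPrefixes (n ∸ j) (suc j) else 0) + N (n ∸ j))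
      ≡⟨ sum-map-+ (λ j → if fits j then totalDecrPrefixes (n ∸ j) (suc j) else 0) (λ j → N (n ∸ j)) (upTo (suc n)) ⟩
    ∑< (suc n) (λ j → if fits j then totalDecrPrefixes (n ∸ j) (suc j) else 0) + ∑< (suc n) (λ j → N (n ∸ j))
      ≡⟨ cong₂ _+_ (∑<-cong (suc n) byInduction) (sym (∑comp-suc n (const 1))) ⟩
    ∑< (suc n) (λ j → ∑< (suc n ∸ j) (term j)) + N (suc n)
      ≡⟨ cong (_+ N (suc n)) (∑<-triangle (suc n) term) ⟩
    ∑< (suc n) (λ i → ∑< (suc i) (λ j → term j (i ∸ j))) + N (suc n)
      ≡⟨ cong (_+ N (suc n)) (∑<-cong (suc n) (λ {i} _ → antidiagonal-sum i)) ⟩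
    ∑< (suc n) (λ i → p≤ (suc i) x * N (n ∸ i)) + N (suc n)
      ≡⟨ +-comm _ (N (suc n)) ⟩
    N (suc n) + ∑< (suc n) (λ i → p≤ (suc i) x * N (n ∸ i))
      ≡⟨ cong (_+ ∑< (suc n) (λ i → p≤ (suc i) x * N (n ∸ i))) (sym (+-identityʳ (N (suc n)))) ⟩
    p≤ 0 x * N (suc n) + ∑< (suc n) (λ i → p≤ (suc i) x * N (n ∸ i))
      ≡⟨ sym (∑<-suc (suc n) (λ i → p≤ i x * N (suc n ∸ i))) ⟩
    ∑< (suc (suc n)) (λ i → p≤ i x * N (suc n ∸ i)) ∎
    where
    N : ℕ → ℕ
    N = #compositions

    fits : ℕ → Bool
    fits j = does (suc j ≤? x)

    term : ℕ → ℕ → ℕ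
    term j k = (if fits j then p≤ k (suc j) else 0) * N (n ∸ j ∸ k)

    byInduction : ∀ {j} → j < suc n →
                  (if fits j then totalDecrPrefixes (n ∸ j) (suc j) else 0) ≡ ∑< (suc n ∸ j) (term j)
    byInduction {j} (s≤s j≤n) = begin
      (if fits j then totalDecrPrefixes (n ∸ j) (suc j) else 0)
        ≡⟨ cong (λ t → if fits j then t else 0) (ih (s≤s (m∸n≤m n j)) (suc j)) ⟩
      (if fits j then ∑< (suc (n ∸ j)) (λ k → p≤ k (suc j) * N (n ∸ j ∸ k)) else 0)
        ≡⟨ sym (sum-map-if (fits j) (λ k → p≤ k (suc j) * N (n ∸ j ∸ k)) (upTo (suc (n ∸ j)))) ⟩
      ∑< (suc (n ∸ j)) (λ k → if fits j then p≤ k (suc j) * N (n ∸ j ∸ k) else 0)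
        ≡⟨ ∑<-cong (suc (n ∸ j)) (λ {k} _ → sym (if-float (_* N (n ∸ j ∸ k)) (fits j))) ⟩
      ∑< (suc (n ∸ j)) (term j)
        ≡⟨ cong (λ l → ∑< l (term j)) (sym (+-∸-assoc 1 j≤n)) ⟩
      ∑< (suc n ∸ j) (term j) ∎

    antidiagonal-sum : ∀ i → ∑< (suc i) (λ j → term j (i ∸ j)) ≡ p≤ (suc i) x * N (n ∸ i)
    antidiagonal-sum i = begin
      ∑< (suc i) (λ j → term j (i ∸ j))
        ≡⟨ ∑<-cong (suc i) (λ {j} j<1+i → cong (λ l → (if fits j then p≤ (i ∸ j) (suc j) else 0) * N l)
                                                     (∸-∸-cancel n (≤-pred j<1+i))) ⟩
      ∑< (suc i) (λ j → (if fits j then p≤ (i ∸ j) (suc j) else 0) * N (n ∸ i))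
        ≡⟨ sum-map-*ʳ (λ j → if fits j then p≤ (i ∸ j) (suc j) else 0) (N (n ∸ i)) (upTo (suc i)) ⟩
      ∑< (suc i) (λ j → if fits j then p≤ (i ∸ j) (suc j) else 0) * N (n ∸ i)
        ≡⟨ cong (_* N (n ∸ i)) (sym (p≤-suc i x)) ⟩
      p≤ (suc i) x * N (n ∸ i) ∎

eqList-refl : ∀ xs → eqList xs xs ≡ true
eqList-refl []       = refl
eqList-refl (x ∷ xs) = trans (cong (_∧ eqList xs xs) (dec-true (x ≟ x) refl)) (eqList-refl xs)

entryA-diagonal : ∀ x c → entryA (x ∷ c) (x ∷ c) ≡ decrPrefixes x c + 1
entryA-diagonal x c = cong (λ b → decrPrefixes x c + (if b then 1 else 0)) (eqList-refl (x ∷ c))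

trA-suc : ∀ n → trA (suc n) ≡ totalDecrPrefixes (suc n) (suc n)
trA-suc n = begin
  ∑comp (suc n) (λ q → entryA q q)
    ≡⟨ ∑comp-suc n (λ q → entryA q q) ⟩
  ∑< (suc n) (λ j → ∑comp (n ∸ j) (λ c → entryA (suc j ∷ c) (suc j ∷ c)))
    ≡⟨ ∑<-cong (suc n) (λ {j} j<1+n → ∑comp-cong (n ∸ j) (λ c → trans (entryA-diagonal (suc j) c) (sym (headFits j<1+n c)))) ⟩
  ∑< (suc n) (λ j → ∑comp (n ∸ j) (λ c → decrPrefixes (suc n) (suc j ∷ c)))
    ≡⟨ sym (∑comp-suc n (decrPrefixes (suc n))) ⟩
  totalDecrPrefixes (suc n) (suc n) ∎
  where
  headFits : ∀ {j} → j < suc n → ∀ c → decrPrefixes (suc n) (suc j ∷ c) ≡ decrPrefixes (suc j) c + 1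
  headFits {j} j<1+n c = trans (decrPrefixes-∷ (suc n) (suc j) c)
    (cong (λ b → (if b then decrPrefixes (suc j) c else 0) + 1) (dec-true (suc j ≤? suc n) j<1+n))

convolution-term : ∀ {i b} → i ≤ b → p≤ i b * #compositions (b ∸ i) ≡ 2 ^ (b ∸ i ∸ 1) * p i
convolution-term {i} {b} i≤b =
  trans (cong₂ _*_ (p≤≡p i b i≤b) (#compositions≡2^[m∸1] (b ∸ i))) (*-comm (p i) _)

theorem10 : (b : ℕ) → trA b ≡ p b + sum (map (λ i → 2 ^ (b ∸ i ∸ 1) * p i) (upTo b))
theorem10 zero      = refl
theorem10 b@(suc n) = begin
  trA b
    ≡⟨ trA-suc n ⟩
  totalDecrPrefixes b b
    ≡⟨ totalDecrPrefixes≡convolution b b ⟩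
  ∑< (suc b) (λ i → p≤ i b * #compositions (b ∸ i))
    ≡⟨ ∑<-cong (suc b) (λ i<1+b → convolution-term (≤-pred i<1+b)) ⟩
  ∑< (suc b) (λ i → 2 ^ (b ∸ i ∸ 1) * p i)
    ≡⟨ ∑<-last b (λ i → 2 ^ (b ∸ i ∸ 1) * p i) ⟩
  ∑< b (λ i → 2 ^ (b ∸ i ∸ 1) * p i) + 2 ^ (b ∸ b ∸ 1) * p b
    ≡⟨ cong (∑< b (λ i → 2 ^ (b ∸ i ∸ 1) * p i) +_)
            (trans (cong (λ e → 2 ^ (e ∸ 1) * p b) (n∸n≡0 b)) (*-identityˡ (p b))) ⟩
  ∑< b (λ i → 2 ^ (b ∸ i ∸ 1) * p i) + p b
    ≡⟨ +-comm _ (p b) ⟩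
  p b + ∑< b (λ i → 2 ^ (b ∸ i ∸ 1) * p i) ∎
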